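{- For every countable ordinal $\xi$, the family $\mathcal{B}^\xi$ is thin, i.e. there are no $\mathbf{s},\mathbf{t}\in\mathcal{B}^\xi$ with $\mathbf{s}\neq\mathbf{t}$ and $\mathbf{s}$ an initial segment of $\mathbf{t}$.
   Context: $\mathbb{N}=\{1,2,\dots\}$. For nonempty $s,t\subseteq\mathbb{N}$ with $s$ finite, $s<t$ means $\max s<\min t$. A finite disjoint collection is a tuple $(s_1,\dots,s_k)$, $k\ge0$ ($\emptyset$ for $k=0$), of nonempty finite subsets of $\mathbb{N}$ with $s_1<\dots<s_k$. Schreier families: fix for each countable limit $\lambda>0$ a strictly increasing sequence $(\lambda_n)$ of successor ordinals $<\lambda$ with supremum $\lambda$. $\mathcal{A}_0=\{\emptyset\}$; $\mathcal{A}_{\zeta+1}=\{\{n\}\cup s_1:s_1\in\mathcal{A}_\zeta,\{n\}<s_1\}$ ($\{n\}<\emptyset$ vacuous); $\mathcal{A}_{\omega^{\beta+1}}=\{s_1\cup\dots\cup s_n:s_1<\dots<s_n\in\mathcal{A}_{\omega^\beta},n=\min s_1\}$; for limit $\lambda>0$, $\mathcal{A}_{\omega^\lambda}=\{s:s\in\mathcal{A}_{\omega^{\lambda_n}},n=\min s\}$; for limit $\xi$ with $\omega^a<\xi<\omega^{a+1}$, $\xi=p\omega^a+\sum_{i=1}^m p_i\omega^{a_i}$ ($m\ge0$, $p,p_i\ge1$, $a>a_1>\dots>a_m>0$, $p>1$ or $m\ge1$): $\mathcal{A}_\xi=\{s_0\cup\dots\cup s_m:s_m<\dots<s_0,\ s_0=s^0_1\cup\dots\cup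 s^0_p$ with $s^0_1<\dots<s^0_p\in\mathcal{A}_{\omega^a}$, $s_i=s^i_1\cup\dots\cup s^i_{p_i}$ with $s^i_1<\dots<s^i_{p_i}\in\mathcal{A}_{\omega^{a_i}}\}$. $\mathcal{B}^0=\{\emptyset\}$; for $\xi\ge1$, $\mathcal{B}^\xi=\{(s_1,\dots,s_k):k\ge1,\ s_1<\dots<s_k,\ \{\min s_1,\dots,\min s_k\}\in\mathcal{A}_\xi\}$. -}

module Defs where

open import Data.Nat using (ℕ; zero; suc; _<_; _≤_)
open import Data.List using (List; []; _∷_; _++_)
open import Data.List.Membership.Propositional using (_∈_)
open import Data.List.Relation.Unary.All using (All)
open import Data.List.Relation.Unary.Linked using (Linked)
open import Data.Product using (Σ; ∃; ∃-syntax; _×_; _,_)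
open import Data.Empty using (⊥)
open import Relation.Binary.PropositionalEquality using (_≡_; _≢_)

-- A limit tree  lim f inc  denotes the
-- supremum of the strictly increasing sequence of SUCCESSOR ordinals
--   λ_n = succ (f n)   (inc : λ_n < λ_{n+1}),
-- i.e. the tree carries its own fixed fundamental sequence (λ_n).
-- _≤_ is the (inductive) order of the denoted ordinals.

data Brw : Set
data _≼_ : Brw → Brw → Set

data Brw where
  bzero : Brw
  bsucc : Brw → Brw
  blim  : (f : ℕ → Brw) → (∀ n → bsucc (bsucc (f n)) ≼ bsucc (f (suc n))) → Brw

data _≼_ where
  z≼   : ∀ {y} → bzero ≼ y
  s≼s  : ∀ {x y} → x ≼ y → bsucc x ≼ bsucc y
  ≼s   : ∀ {x y} → x ≼ y → x ≼ bsucc y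
  ≼lim : ∀ {x f inc} n → x ≼ bsucc (f n) → x ≼ blim f inc
  lim≼ : ∀ {f inc y} → (∀ n → bsucc (f n) ≼ y) → blim f inc ≼ y

_≺_ : Brw → Brw → Set
x ≺ y = bsucc x ≼ y

-- Cantor normal form, LOWEST term first:
--   [(a_m , p_m) , … , (a_0 , p_0)]  denotes  ω^{a_0} p_0 + … + ω^{a_m} p_m
-- with a_m < … < a_0 and all p_i ≥ 1.  The empty list denotes 0.
data IsCNF : List (Brw × ℕ) → Set where
  cnf[]  : IsCNF []
  cnf1   : ∀ {a p} → 1 ≤ p → IsCNF ((a , p) ∷ [])
  cnf∷   : ∀ {a p b q ζ} → 1 ≤ p → a ≺ b → IsCNF ((b , q) ∷ ζ)
         → IsCNF ((a , p) ∷ (b , q) ∷ ζ)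

CountableOrdinal : Set
CountableOrdinal = Σ (List (Brw × ℕ)) IsCNF

-- Finite subsets of ℕ = {1,2,…} are strictly increasing lists.

_⋖_ : List ℕ → List ℕ → Set
s ⋖ t = ∀ {x y} → x ∈ s → y ∈ t → x < y

UnionOf : (List ℕ → Set) → ℕ → List ℕ → Set
UnionOf P zero    s = s ≡ []
UnionOf P (suc k) s = ∃[ s₁ ] ∃[ t ] (s ≡ s₁ ++ t × P s₁ × UnionOf P k t × s₁ ⋖ t)

SuccFam : (List ℕ → Set) → List ℕ → Set
SuccFam P s = ∃[ n ] ∃[ s₁ ] (s ≡ n ∷ s₁ × 1 ≤ n × P s₁ × (n ∷ []) ⋖ s₁)

Apow : Brw → List ℕ → Set
Apow bzero        s = SuccFam (λ t → t ≡ []) s            -- A_1 = A_{0+1}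
Apow (bsucc b)    s = ∃[ n ] ∃[ r ] (s ≡ n ∷ r × UnionOf (Apow b) n s)
Apow (blim f inc) s = ∃[ n ] ∃[ r ] (s ≡ n ∷ r ×          -- s ∈ A_{ω^{λ_n}}, λ_n = succ (f n)
                        ∃[ m ] ∃[ r′ ] (s ≡ m ∷ r′ × UnionOf (Apow (f n)) m s))

SuccIter : ℕ → (List ℕ → Set) → List ℕ → Set
SuccIter zero    P = P
SuccIter (suc k) P = SuccFam (SuccIter k P)

ALimit : List (Brw × ℕ) → List ℕ → Set
ALimit []            s = s ≡ []
ALimit ((a , p) ∷ ζ) s = ∃[ u ] ∃[ t ] (s ≡ u ++ t × UnionOf (Apow a) p u × ALimit ζ t × u ⋖ t)

A : List (Brw × ℕ) → List ℕ → Set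
A []                            s = s ≡ []
A ((bzero , k) ∷ ζ)             s = SuccIter k (A ζ) s     -- ξ = ζ + k
A ((bsucc b , 1) ∷ [])          s = Apow (bsucc b) s
A ((blim f inc , 1) ∷ [])       s = Apow (blim f inc) s
A ((bsucc b , p) ∷ ζ)           s = ALimit ((bsucc b , p) ∷ ζ) s
A ((blim f inc , p) ∷ ζ)        s = ALimit ((blim f inc , p) ∷ ζ) s

IsFinSet : List ℕ → Set
IsFinSet s = Linked _<_ s × All (1 ≤_) s

NonEmpty : List ℕ → Set
NonEmpty s = s ≢ []

data Ordered : List (List ℕ) → Set where
  ord[] : Ordered []
  ord1  : ∀ {s} → Ordered (s ∷ [])
  ord∷  : ∀ {s t ss} → s ⋖ t → Ordered (t ∷ ss) → Ordered (s ∷ t ∷ ss)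

mins : List (List ℕ) → List ℕ
mins []             = []
mins ([] ∷ ss)      = mins ss
mins ((x ∷ _) ∷ ss) = x ∷ mins ss

B : CountableOrdinal → List (List ℕ) → Set
B ([] , _)    ss = ss ≡ []
B (ξ@(_ ∷ _) , _) ss = ss ≢ [] × All IsFinSet ss × All NonEmpty ss × Ordered ss × A ξ (mins ss)

InitialSegment : List (List ℕ) → List (List ℕ) → Set
InitialSegment s t = ∃[ u ] (t ≡ s ++ u)

Thin : (List (List ℕ) → Set) → Set
Thin F = ∀ s t → F s → F t → s ≢ t → InitialSegment s t → ⊥

{-# OPTIONS --safe #-}
module Submission where

-- Every family A_ξ is prefix-free: no member is a proper initial segment of
-- another.  This survives each step of the construction, because whenever a
-- set is cut into consecutive blocks the number of blocks is fixed either by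
-- the ordinal or by the minimum of the set, and if one set is an initial
-- segment of another and both have first blocks in a prefix-free family, those
-- first blocks coincide.
-- B^ξ inherits the property through  mins : extending a collection by
-- nonempty sets properly extends its list of minima.

open import Defs
open import Data.Nat using (ℕ; zero; suc)
open import Data.List using (List; []; _∷_; _++_)
open import Data.List.Properties using (++-assoc; ++-identityʳ; ∷-injective; ∷-injectiveʳ)
open import Data.List.Relation.Unary.All using (All; _∷_)
open import Data.List.Relation.Unary.All.Properties using (++⁻ʳ)
open import Data.Product using (∃-syntax; _×_; _,_)
open import Data.Sum using (_⊎_; inj₁; inj₂)
open import Data.Empty using (⊥-elim)
open import Relation.Binary.PropositionalEquality using (_≡_; refl; sym; trans; cong; subst)

PrefixFree : {X : Set} → (List X → Set) → Set
PrefixFree P = ∀ {s u} → P s → P (s ++ u) → u ≡ []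

prefixFree⇒thin : {F : List (List ℕ) → Set} → PrefixFree F → Thin F
prefixFree⇒thin pf s .(s ++ u) Fs Fs++u s≢s++u (u , refl) =
  s≢s++u (sym (trans (cong (s ++_) (pf Fs Fs++u)) (++-identityʳ s)))

≡[]-prefixFree : {X : Set} → PrefixFree {X} (_≡ [])
≡[]-prefixFree refl u≡[] = u≡[]

++≡++⇒comparable : {X : Set} (a b c d : List X) → a ++ b ≡ c ++ d →
  (∃[ w ] (c ≡ a ++ w × b ≡ w ++ d)) ⊎ (∃[ w ] (a ≡ c ++ w × d ≡ w ++ b))
++≡++⇒comparable []      b c       d e = inj₁ (c , refl , e)
++≡++⇒comparable (x ∷ a) b []      d e = inj₂ (x ∷ a , refl , sym e)
++≡++⇒comparable (x ∷ a) b (y ∷ c) d e with ∷-injective e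
... | refl , a++b≡c++d with ++≡++⇒comparable a b c d a++b≡c++d
...   | inj₁ (w , c≡a++w , b≡w++d) = inj₁ (w , cong (x ∷_) c≡a++w , b≡w++d)
...   | inj₂ (w , a≡c++w , d≡w++b) = inj₂ (w , cong (x ∷_) a≡c++w , d≡w++b)

prefixFree-++-cancelˡ : {X : Set} {P : List X → Set} → PrefixFree P →
  ∀ {a b c d} → P a → P c → a ++ b ≡ c ++ d → b ≡ d
prefixFree-++-cancelˡ pf {a} {b} {c} {d} Pa Pc e with ++≡++⇒comparable a b c d e
... | inj₁ (w , refl , b≡w++d) = trans b≡w++d (cong (_++ d) (pf Pa Pc))
... | inj₂ (w , refl , d≡w++b) = sym (trans d≡w++b (cong (_++ b) (pf Pc Pa)))

OrderedConcat : (List ℕ → Set) → (List ℕ → Set) → List ℕ → Set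
OrderedConcat P Q s = ∃[ s₁ ] ∃[ t ] (s ≡ s₁ ++ t × P s₁ × Q t × s₁ ⋖ t)

orderedConcat-prefixFree : {P Q : List ℕ → Set} →
  PrefixFree P → PrefixFree Q → PrefixFree (OrderedConcat P Q)
orderedConcat-prefixFree {Q = Q} pfP pfQ {u = u}
  (s₁ , t , refl , Ps₁ , Qt , _) (s₁′ , t′ , e , Ps₁′ , Qt′ , _) =
  pfQ {t} Qt (subst Q (sym t++u≡t′) Qt′)
  where
    t++u≡t′ : t ++ u ≡ t′
    t++u≡t′ = prefixFree-++-cancelˡ pfP {s₁} {c = s₁′} Ps₁ Ps₁′ (trans (sym (++-assoc s₁ t u)) e)

UnionOf-prefixFree : {P : List ℕ → Set} → PrefixFree P → ∀ k → PrefixFree (UnionOf P k)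
UnionOf-prefixFree pf zero    = ≡[]-prefixFree
UnionOf-prefixFree pf (suc k) = orderedConcat-prefixFree pf (UnionOf-prefixFree pf k)

SuccFam-prefixFree : {P : List ℕ → Set} → PrefixFree P → PrefixFree (SuccFam P)
SuccFam-prefixFree {P} pf (_ , _ , refl , _ , Ps₁ , _) (_ , _ , e , _ , Ps₁′ , _) =
  pf Ps₁ (subst P (sym (∷-injectiveʳ e)) Ps₁′)

SuccIter-prefixFree : {P : List ℕ → Set} → PrefixFree P → ∀ k → PrefixFree (SuccIter k P)
SuccIter-prefixFree pf zero    = pf
SuccIter-prefixFree pf (suc k) = SuccFam-prefixFree (SuccIter-prefixFree pf k)

HeadIndexed : (ℕ → List ℕ → Set) → List ℕ → Set
HeadIndexed Q s = ∃[ n ] ∃[ r ] (s ≡ n ∷ r × Q n s)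

headIndexed-prefixFree : {Q : ℕ → List ℕ → Set} →
  (∀ n → PrefixFree (Q n)) → PrefixFree (HeadIndexed Q)
headIndexed-prefixFree pf (n , _ , refl , Qs) (_ , _ , e , Qs++u) with ∷-injective e
... | refl , _ = pf n Qs Qs++u

Apow-prefixFree : ∀ a → PrefixFree (Apow a)
Apow-prefixFree bzero        = SuccFam-prefixFree ≡[]-prefixFree
Apow-prefixFree (bsucc b)    = headIndexed-prefixFree (UnionOf-prefixFree (Apow-prefixFree b))
Apow-prefixFree (blim f inc) =
  headIndexed-prefixFree {Q = λ n → HeadIndexed (UnionOf (Apow (f n)))} λ n →
    headIndexed-prefixFree (UnionOf-prefixFree (Apow-prefixFree (f n)))

ALimit-prefixFree : ∀ ζ → PrefixFree (ALimit ζ)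
ALimit-prefixFree []            = ≡[]-prefixFree
ALimit-prefixFree ((a , p) ∷ ζ) =
  orderedConcat-prefixFree (UnionOf-prefixFree (Apow-prefixFree a) p) (ALimit-prefixFree ζ)

A-prefixFree : ∀ ξ → PrefixFree (A ξ)
A-prefixFree []                                  = ≡[]-prefixFree
A-prefixFree ((bzero , k) ∷ ζ)                   = SuccIter-prefixFree (A-prefixFree ζ) k
A-prefixFree ((bsucc b , 1) ∷ [])                = Apow-prefixFree (bsucc b)
A-prefixFree ((blim f inc , 1) ∷ [])             = Apow-prefixFree (blim f inc)
A-prefixFree ξ@((bsucc b , zero) ∷ ζ)            = ALimit-prefixFree ξ
A-prefixFree ξ@((bsucc b , suc zero) ∷ _ ∷ ζ)    = ALimit-prefixFree ξ
A-prefixFree ξ@((bsucc b , suc (suc p)) ∷ ζ)     = ALimit-prefixFree ξ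
A-prefixFree ξ@((blim f inc , zero) ∷ ζ)         = ALimit-prefixFree ξ
A-prefixFree ξ@((blim f inc , suc zero) ∷ _ ∷ ζ) = ALimit-prefixFree ξ
A-prefixFree ξ@((blim f inc , suc (suc p)) ∷ ζ)  = ALimit-prefixFree ξ

mins-++ : ∀ ss us → mins (ss ++ us) ≡ mins ss ++ mins us
mins-++ []             us = refl
mins-++ ([] ∷ ss)      us = mins-++ ss us
mins-++ ((x ∷ _) ∷ ss) us = cong (x ∷_) (mins-++ ss us)

mins≡[]⇒≡[] : ∀ {ss} → All NonEmpty ss → mins ss ≡ [] → ss ≡ []
mins≡[]⇒≡[] {[]}          _        _  = refl
mins≡[]⇒≡[] {[] ∷ _}      (ne ∷ _) _  = ⊥-elim (ne refl)
mins≡[]⇒≡[] {(_ ∷ _) ∷ _} _        ()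

B-prefixFree : ∀ ξ → PrefixFree (B ξ)
B-prefixFree ([] , _) = ≡[]-prefixFree
B-prefixFree (ξ@(_ ∷ _) , _) {ss} {us} (_ , _ , _ , _ , Aξ-ss) (_ , _ , ne , _ , Aξ-ss++us) =
  mins≡[]⇒≡[] (++⁻ʳ ss ne)
    (A-prefixFree ξ {mins ss} Aξ-ss (subst (A ξ) (mins-++ ss us) Aξ-ss++us))

proposition2p2 : (ξ : CountableOrdinal) → Thin (B ξ)
proposition2p2 ξ = prefixFree⇒thin (B-prefixFree ξ)
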